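{- Let $n\ge 1$ and $0\le k\le n$ be integers. Let $v_{n,k}$ be the number of pairs $(W,T)$, where $W$ is a $k$-element subset of the set of rows $\{1,\dots,n\}$ of an $n\times 2$ grid (the rows with a vertical wall) and $T$ is a valid filling of the grid with respect to $W$. Then $$v_{n,k}=\frac{1}{n+1-k}\binom{n}{k}\binom{2n}{n}.$$
   Context: Consider a rectangular grid with $n$ rows, numbered $1,\dots,n$ from bottom to top, and $2$ columns. A filling is a bijection from the $2n$ cells to $\{1,2,\dots,2n\}$. Given a set $W\subseteq\{1,\dots,n\}$ of rows, said to carry a vertical wall between their two cells, a filling is valid with respect to $W$ if it satisfies three conditions. (i) The labels in each column increase from bottom to top. (ii) In every row not in $W$, the left label is smaller than the right label. (iii) In a row belonging to $W$, no order constraint is imposed between its two cells. -}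

module Defs where

open import Data.Nat using (ℕ; _*_)
open import Data.Fin using (Fin; _<_; _<?_)
open import Data.Fin.Properties using (all?; any?) renaming (_≟_ to _≟ᶠ_)
open import Data.Fin.Subset using (Subset; _∈_; _∉_; ∣_∣)
open import Data.Fin.Subset.Properties using (_∈?_)
open import Data.Vec using (Vec; lookup)
open import Data.Product using (_×_; _,_; Σ; ∃; proj₁; proj₂)
open import Data.Product.Properties using (≡-dec)
open import Relation.Binary.PropositionalEquality using (_≡_)
open import Relation.Nullary using (Dec; ¬_)
open import Relation.Nullary.Decidable using (True; _×-dec_; _→-dec_; ¬?; map′)
import Data.Nat.Properties as ℕP

-- A cell of the n × 2 grid: (row, column).  Rows 0..n-1 (Fin n) stand for
-- rows 1..n, numbered from bottom to top; column 0 is the left column,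
-- column 1 the right column.
Cell : ℕ → Set
Cell n = Fin n × Fin 2

-- A labelling of the cells by {1,...,2n}, represented by Fin (2 * n)
-- (label j ∈ Fin (2n) stands for j+1; the order is preserved).
Labelling : ℕ → Set
Labelling n = Vec (Fin (2 * n) × Fin (2 * n)) n

label : ∀ {n} → Labelling n → Cell n → Fin (2 * n)
label T (i , c) with lookup T i
... | (l , r) = lab c l r
  where
  lab : ∀ {m} → Fin 2 → Fin m → Fin m → Fin m
  lab Fin.zero l r = l
  lab (Fin.suc Fin.zero) l r = r

IsFilling : ∀ {n} → Labelling n → Set
IsFilling {n} T =
  (∀ (x y : Cell n) → label T x ≡ label T y → x ≡ y) ×
  (∀ (m : Fin (2 * n)) → ∃ λ (x : Cell n) → label T x ≡ m)

ColumnsIncrease : ∀ {n} → Labelling n → Set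
ColumnsIncrease {n} T =
  ∀ (c : Fin 2) (i j : Fin n) → i < j → label T (i , c) < label T (j , c)

RowsOK : ∀ {n} → Subset n → Labelling n → Set
RowsOK {n} W T =
  ∀ (i : Fin n) → i ∉ W → label T (i , Fin.zero) < label T (i , Fin.suc Fin.zero)

ValidFilling : ∀ {n} → Subset n → Labelling n → Set
ValidFilling W T = IsFilling T × ColumnsIncrease T × RowsOK W T

Counted : (n k : ℕ) → Subset n → Labelling n → Set
Counted n k W T = (∣ W ∣ ≡ k) × ValidFilling W T

-- Decidability (used only so that the counted objects form a set with
-- proof-irrelevant membership witnesses, see `Pairs` below).

private
  _≟c_ : ∀ {n} (x y : Cell n) → Dec (x ≡ y)
  _≟c_ = ≡-dec _≟ᶠ_ _≟ᶠ_

  allC? : ∀ {n} {P : Cell n → Set} → (∀ x → Dec (P x)) → Dec (∀ x → P x)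
  allC? P? = map′ (λ h → λ { (i , c) → h i c }) (λ h i c → h (i , c))
                  (all? λ i → all? λ c → P? (i , c))

  anyC? : ∀ {n} {P : Cell n → Set} → (∀ x → Dec (P x)) → Dec (∃ P)
  anyC? P? = map′ (λ { (i , c , p) → (i , c) , p }) (λ { ((i , c) , p) → i , c , p })
                  (any? λ i → any? λ c → P? (i , c))

isFilling? : ∀ {n} (T : Labelling n) → Dec (IsFilling T)
isFilling? {n} T =
  allC? (λ x → allC? (λ y → (label T x ≟ᶠ label T y) →-dec (x ≟c y)))
  ×-dec all? (λ m → anyC? (λ x → label T x ≟ᶠ m))

columnsIncrease? : ∀ {n} (T : Labelling n) → Dec (ColumnsIncrease T)
columnsIncrease? T =
  all? λ c → all? λ i → all? λ j → (i <? j) →-dec (label T (i , c) <? label T (j , c))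

rowsOK? : ∀ {n} (W : Subset n) (T : Labelling n) → Dec (RowsOK W T)
rowsOK? W T =
  all? λ i → ¬? (i ∈? W) →-dec (label T (i , Fin.zero) <? label T (i , Fin.suc Fin.zero))

counted? : ∀ n k (W : Subset n) (T : Labelling n) → Dec (Counted n k W T)
counted? n k W T =
  (∣ W ∣ ℕP.≟ k) ×-dec (isFilling? T ×-dec (columnsIncrease? T ×-dec rowsOK? W T))

-- Membership is witnessed by
-- `True (counted? …)`, which is proof-irrelevant, so this type has
-- exactly one element per such pair.
Pairs : (n k : ℕ) → Set
Pairs n k = Σ (Subset n × Labelling n) λ { (W , T) → True (counted? n k W T) }

module Submission where

-- A filling whose columns increase is a word in L and R of length 2n:
-- label t (t = 0,…,2n-1) goes to the column named by the t-th letter.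
-- Row i is *bad* (right label < left label) iff the i-th R precedes the
-- i-th L, and we call such an L a *flaw*.  Condition (ii) says that the
-- walls W contain the bad rows, so a filling with j bad rows admits
-- C(n-j,k-j) wall sets of size k, and v = Σ_j nWords n n j · C(n-j,k-j).
-- By the Chung–Feller theorem nWords n n j = catalan n for every j ≤ n;
-- the hockey-stick identity, (n+1-k)·C(n+1,k) = (n+1)·C(n,k) and
-- (n+1)·catalan n = C(2n,n) then give (n+1-k)·v = C(n,k)·C(2n,n).

open import Defs
open import Data.Nat using (ℕ; zero; suc; _+_; _*_; _∸_; _≤_; _<_; z≤n; s≤s; _<ᵇ_; _≤ᵇ_)
open import Data.Nat.Properties
open import Data.Nat.Combinatorics using (_C_; nCk+nC[k+1]≡[n+1]C[k+1]; nCn≡1)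
open import Data.Bool using (Bool; true; false) renaming (T to Tᵇ)
open import Data.Bool.Properties using (T-irrelevant)
open import Data.Unit using (⊤; tt)
open import Data.Empty using (⊥; ⊥-elim; ⊥-elim-irr)
open import Data.Fin using (Fin; toℕ; fromℕ<) renaming (_<_ to _<ᶠ_)
open import Data.Fin.Properties using (toℕ-injective; toℕ<n; toℕ-fromℕ<; fromℕ<-toℕ; +↔⊎; *↔×)
  renaming (<-cmp to <ᶠ-cmp)
open import Data.Fin.Subset using (Subset; ∣_∣; _⊆_) renaming (_∈_ to _∈ₛ_)
open import Data.Fin.Subset.Properties using (_∈?_; ∣p∣≤n; drop-∷-⊆; out⊆; s⊆s)
open import Data.Vec using (Vec; []; _∷_; _∷ʳ_; initLast; lookup; map; zip) renaming (here to here[]=)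
open import Data.Vec.Properties using (∷ʳ-injective; lookup-map; []=⇒lookup; lookup⇒[]=)
open import Data.Vec.Membership.Propositional using (_∈_)
open import Data.Vec.Membership.Propositional.Properties using (∈-lookup)
open import Data.Vec.Relation.Unary.Any as Any using (here; there)
open import Data.Vec.Relation.Unary.Any.Properties using (lookup-index)
open import Data.Sum using (_⊎_; inj₁; inj₂)
open import Data.Sum.Function.Propositional using (_⊎-↔_)
open import Data.Product using (Σ; _×_; _,_; proj₁; proj₂)
open import Data.Product.Function.NonDependent.Propositional using (_×-↔_)
open import Data.Product.Function.Dependent.Propositional using (Σ-↔)
open import Function using (_∘_)
open import Function.Bundles using (_↔_; mk↔ₛ′)
open import Function.Properties.Inverse using (↔-refl; ↔-sym; ↔-trans)
open import Function.Related.TypeIsomorphisms using (Σ-assoc)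
open import Relation.Nullary using (Dec; yes; no)
open import Relation.Nullary.Decidable using (True; recompute; _×-dec_; toWitness; fromWitness)
open import Relation.Binary.Definitions using (tri<; tri≈; tri>)
open import Relation.Binary.PropositionalEquality
open import Algebra.Properties.CommutativeSemigroup +-commutativeSemigroup
  using () renaming (interchange to +-interchange; x∙yz≈y∙xz to +-swapˡ)
open import Algebra.Properties.CommutativeSemigroup *-commutativeSemigroup
  using () renaming (x∙yz≈y∙xz to *-swapˡ)
open ≡-Reasoning

-- Binomial coefficients by Pascal's rule.  Being a structural recursion,
-- `binom` unfolds definitionally in the counting recursions below;
-- `binom≡C` identifies it with the library's `_C_`.
binom : ℕ → ℕ → ℕ
binom n       zero    = 1
binom zero    (suc k) = 0
binom (suc n) (suc k) = binom n k + binom n (suc k)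

binom≡C : ∀ n k → binom n k ≡ n C k
binom≡C n       zero    = refl
binom≡C zero    (suc k) = refl
binom≡C (suc n) (suc k) =
  trans (cong₂ _+_ (binom≡C n k) (binom≡C n (suc k))) (nCk+nC[k+1]≡[n+1]C[k+1] n k)

binom-diag : ∀ n → binom n n ≡ 1
binom-diag n = trans (binom≡C n n) (nCn≡1 n)

binom-1 : ∀ n → binom n 1 ≡ n
binom-1 zero    = refl
binom-1 (suc n) = cong suc (binom-1 n)

binom-absorption : ∀ n k → suc k * binom (suc n) (suc k) ≡ suc n * binom n k
binom-absorption zero    zero    = refl
binom-absorption zero    (suc k) = *-zeroʳ (suc (suc k))
binom-absorption (suc n) zero    =
  trans (+-identityʳ _) (trans (binom-1 (suc (suc n))) (sym (*-identityʳ (suc (suc n)))))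
binom-absorption (suc n) (suc k) = begin
  suc (suc k) * (X + Y)
    ≡⟨ *-distribˡ-+ (suc (suc k)) X Y ⟩
  (X + suc k * X) + suc (suc k) * Y
    ≡⟨ cong₂ (λ u v → (X + u) + v) (binom-absorption n k) (binom-absorption n (suc k)) ⟩
  (X + suc n * binom n k) + suc n * binom n (suc k)
    ≡⟨ +-assoc X _ _ ⟩
  X + (suc n * binom n k + suc n * binom n (suc k))
    ≡⟨ cong (X +_) (sym (*-distribˡ-+ (suc n) (binom n k) (binom n (suc k)))) ⟩
  X + suc n * X ∎
  where
  X = binom (suc n) (suc k)
  Y = binom (suc n) (suc (suc k))

-- The complementary form (n+1-k)·C(n+1,k) = (n+1)·C(n,k), which is where
-- the factor n+1-k of the theorem comes from: add k·C(n+1,k) to both sides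
-- and use absorption.
binom-complement : ∀ n k → k ≤ n → (suc n ∸ k) * binom (suc n) k ≡ suc n * binom n k
binom-complement n zero    _   = refl
binom-complement n (suc k) k<n = +-cancelˡ-≡ (suc k * X) _ _ (begin
  suc k * X + (n ∸ k) * X
    ≡⟨ sym (*-distribʳ-+ X (suc k) (n ∸ k)) ⟩
  (suc k + (n ∸ k)) * X
    ≡⟨ cong (λ m → suc m * X) (m+[n∸m]≡n (<⇒≤ k<n)) ⟩
  suc n * X
    ≡⟨ *-distribˡ-+ (suc n) (binom n k) (binom n (suc k)) ⟩
  suc n * binom n k + suc n * binom n (suc k)
    ≡⟨ cong (_+ suc n * binom n (suc k)) (sym (binom-absorption n k)) ⟩
  suc k * X + suc n * binom n (suc k) ∎)
  where
  X = binom (suc n) (suc k)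

Σ≤ : ℕ → (ℕ → ℕ) → ℕ
Σ≤ zero    f = f 0
Σ≤ (suc n) f = f 0 + Σ≤ n (λ i → f (suc i))

Σ≤-cong : ∀ n {f g} → (∀ i → i ≤ n → f i ≡ g i) → Σ≤ n f ≡ Σ≤ n g
Σ≤-cong zero    f≗g = f≗g 0 z≤n
Σ≤-cong (suc n) f≗g = cong₂ _+_ (f≗g 0 z≤n) (Σ≤-cong n (λ i i≤n → f≗g (suc i) (s≤s i≤n)))

Σ≤-+ : ∀ n f g → Σ≤ n (λ i → f i + g i) ≡ Σ≤ n f + Σ≤ n g
Σ≤-+ zero    f g = refl
Σ≤-+ (suc n) f g =
  trans (cong (f 0 + g 0 +_) (Σ≤-+ n (λ i → f (suc i)) (λ i → g (suc i)))) (+-interchange (f 0) (g 0) _ _)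

Σ≤-last : ∀ n f → Σ≤ (suc n) f ≡ Σ≤ n f + f (suc n)
Σ≤-last zero    f = refl
Σ≤-last (suc n) f = trans (cong (f 0 +_) (Σ≤-last n (λ i → f (suc i)))) (sym (+-assoc (f 0) _ _))

Σ≤-*ˡ : ∀ n c f → Σ≤ n (λ i → c * f i) ≡ c * Σ≤ n f
Σ≤-*ˡ zero    c f = refl
Σ≤-*ˡ (suc n) c f =
  trans (cong (c * f 0 +_) (Σ≤-*ˡ n c (λ i → f (suc i)))) (sym (*-distribˡ-+ c (f 0) _))

Σ≤-zero : ∀ n f → (∀ i → f i ≡ 0) → Σ≤ n f ≡ 0
Σ≤-zero zero    f f≗0 = f≗0 0
Σ≤-zero (suc n) f f≗0 = cong₂ _+_ (f≗0 0) (Σ≤-zero n (λ i → f (suc i)) (λ i → f≗0 (suc i)))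

Σ≤-const : ∀ n c → Σ≤ n (λ _ → c) ≡ suc n * c
Σ≤-const zero    c = sym (+-identityʳ c)
Σ≤-const (suc n) c = cong (c +_) (Σ≤-const n c)

conv : (ℕ → ℕ) → (ℕ → ℕ) → ℕ → ℕ
conv f g zero    = f 0 * g 0
conv f g (suc n) = f 0 * g (suc n) + conv (λ i → f (suc i)) g n

conv-cong : ∀ {f f′ g g′} n → (∀ i → f i ≡ f′ i) → (∀ i → g i ≡ g′ i) → conv f g n ≡ conv f′ g′ n
conv-cong zero    f≗ g≗ = cong₂ _*_ (f≗ 0) (g≗ 0)
conv-cong (suc n) f≗ g≗ =
  cong₂ _+_ (cong₂ _*_ (f≗ 0) (g≗ (suc n))) (conv-cong n (λ i → f≗ (suc i)) g≗)

conv-last : ∀ f g n → conv f g (suc n) ≡ f (suc n) * g 0 + conv f (λ i → g (suc i)) n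
conv-last f g zero    = +-comm (f 0 * g 1) (f 1 * g 0)
conv-last f g (suc n) = begin
  f 0 * g (suc (suc n)) + conv f′ g (suc n)
    ≡⟨ cong (f 0 * g (suc (suc n)) +_) (conv-last f′ g n) ⟩
  f 0 * g (suc (suc n)) + (f (suc (suc n)) * g 0 + conv f′ g′ n)
    ≡⟨ +-swapˡ (f 0 * g (suc (suc n))) (f (suc (suc n)) * g 0) (conv f′ g′ n) ⟩
  f (suc (suc n)) * g 0 + (f 0 * g (suc (suc n)) + conv f′ g′ n) ∎
  where
  f′ g′ : ℕ → ℕ
  f′ i = f (suc i)
  g′ i = g (suc i)

conv-comm : ∀ f g n → conv f g n ≡ conv g f n
conv-comm f g zero    = *-comm (f 0) (g 0)
conv-comm f g (suc n) = begin
  f 0 * g (suc n) + conv (λ i → f (suc i)) g n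
    ≡⟨ cong₂ _+_ (*-comm (f 0) (g (suc n))) (conv-comm (λ i → f (suc i)) g n) ⟩
  g (suc n) * f 0 + conv g (λ i → f (suc i)) n
    ≡⟨ sym (conv-last g f n) ⟩
  conv g f (suc n) ∎

conv-+ʳ : ∀ f g h n → conv f (λ i → g i + h i) n ≡ conv f g n + conv f h n
conv-+ʳ f g h zero    = *-distribˡ-+ (f 0) (g 0) (h 0)
conv-+ʳ f g h (suc n) = begin
  f 0 * (g (suc n) + h (suc n)) + conv f′ (λ i → g i + h i) n
    ≡⟨ cong₂ _+_ (*-distribˡ-+ (f 0) (g (suc n)) (h (suc n))) (conv-+ʳ f′ g h n) ⟩
  (f 0 * g (suc n) + f 0 * h (suc n)) + (conv f′ g n + conv f′ h n)
    ≡⟨ +-interchange (f 0 * g (suc n)) (f 0 * h (suc n)) (conv f′ g n) (conv f′ h n) ⟩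
  (f 0 * g (suc n) + conv f′ g n) + (f 0 * h (suc n) + conv f′ h n) ∎
  where
  f′ : ℕ → ℕ
  f′ i = f (suc i)

conv-+ˡ : ∀ f g h n → conv (λ i → f i + g i) h n ≡ conv f h n + conv g h n
conv-+ˡ f g h n = begin
  conv (λ i → f i + g i) h n ≡⟨ conv-comm _ h n ⟩
  conv h (λ i → f i + g i) n ≡⟨ conv-+ʳ h f g n ⟩
  conv h f n + conv h g n    ≡⟨ cong₂ _+_ (conv-comm h f n) (conv-comm h g n) ⟩
  conv f h n + conv g h n    ∎

conv-zeroʳ : ∀ f n → conv f (λ _ → 0) n ≡ 0
conv-zeroʳ f zero    = *-zeroʳ (f 0)
conv-zeroʳ f (suc n) = cong₂ _+_ (*-zeroʳ (f 0)) (conv-zeroʳ (λ i → f (suc i)) n)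

conv-peel : ∀ f g h n → g 0 ≡ 1 → (∀ u → g (suc u) ≡ h u) → conv f g (suc n) ≡ f (suc n) + conv f h n
conv-peel f g h n g0≡1 g≗h = begin
  conv f g (suc n)
    ≡⟨ conv-last f g n ⟩
  f (suc n) * g 0 + conv f (λ u → g (suc u)) n
    ≡⟨ cong₂ _+_ (trans (cong (f (suc n) *_) g0≡1) (*-identityʳ _)) (conv-cong n (λ _ → refl) g≗h) ⟩
  f (suc n) + conv f h n ∎

conv-split : ∀ f g g₁ g₂ n → g 0 ≡ g₁ 0 → (∀ u → g (suc u) ≡ g₁ (suc u) + g₂ u) →
             conv f g (suc n) ≡ conv f g₁ (suc n) + conv f g₂ n
conv-split f g g₁ g₂ n g0 g-rec = begin
  conv f g (suc n)
    ≡⟨ conv-last f g n ⟩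
  f (suc n) * g 0 + conv f (λ u → g (suc u)) n
    ≡⟨ cong₂ _+_ (cong (f (suc n) *_) g0) (conv-cong n (λ _ → refl) g-rec) ⟩
  f (suc n) * g₁ 0 + conv f (λ u → g₁ (suc u) + g₂ u) n
    ≡⟨ cong (f (suc n) * g₁ 0 +_) (conv-+ʳ f (λ u → g₁ (suc u)) g₂ n) ⟩
  f (suc n) * g₁ 0 + (conv f (λ u → g₁ (suc u)) n + conv f g₂ n)
    ≡⟨ sym (+-assoc (f (suc n) * g₁ 0) _ _) ⟩
  (f (suc n) * g₁ 0 + conv f (λ u → g₁ (suc u)) n) + conv f g₂ n
    ≡⟨ cong (_+ conv f g₂ n) (sym (conv-last f g₁ n)) ⟩
  conv f g₁ (suc n) + conv f g₂ n ∎

-- Appending L to a word with a L's and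
-- b R's creates a *flaw* when a < b; in the grid this is a row whose
-- right label is smaller than its left label.  `shiftIf flaw f` is the
-- count f after possibly recording one more flaw.
shiftIf : Bool → (ℕ → ℕ) → ℕ → ℕ
shiftIf true  f zero    = 0
shiftIf true  f (suc j) = f j
shiftIf false f j       = f j

-- nWords a b j : the number of words with a L's, b R's and j flaws,
-- by recursion on the last letter.
nWords : ℕ → ℕ → ℕ → ℕ
nWords zero    zero    zero    = 1
nWords zero    zero    (suc j) = 0
nWords zero    (suc b) j       = nWords zero b j
nWords (suc a) zero    j       = shiftIf (a <ᵇ zero) (nWords a zero) j
nWords (suc a) (suc b) j       = shiftIf (a <ᵇ suc b) (nWords a (suc b)) j + nWords (suc a) b j

nWordsL : ℕ → ℕ → ℕ → ℕ
nWordsL a b = shiftIf (a <ᵇ b) (nWords a b)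

<ᵇ-true : ∀ {a b} → a < b → (a <ᵇ b) ≡ true
<ᵇ-true {zero}  (s≤s _)       = refl
<ᵇ-true {suc a} (s≤s (s≤s p)) = <ᵇ-true {a} (s≤s p)

<ᵇ-false : ∀ {a b} → b ≤ a → (a <ᵇ b) ≡ false
<ᵇ-false z≤n     = refl
<ᵇ-false (s≤s p) = <ᵇ-false p

≤ᵇ-true : ∀ {a b} → a ≤ b → (a ≤ᵇ b) ≡ true
≤ᵇ-true z≤n     = refl
≤ᵇ-true (s≤s p) = <ᵇ-true (s≤s p)

≤ᵇ-false : ∀ {a b} → b < a → (a ≤ᵇ b) ≡ false
≤ᵇ-false (s≤s p) = <ᵇ-false p

nWordsL-flaw₀ : ∀ a b → a < b → nWordsL a b 0 ≡ 0
nWordsL-flaw₀ a b a<b rewrite <ᵇ-true a<b = refl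

nWordsL-flaw : ∀ a b j → a < b → nWordsL a b (suc j) ≡ nWords a b j
nWordsL-flaw a b j a<b rewrite <ᵇ-true a<b = refl

nWordsL-noFlaw : ∀ a b j → b ≤ a → nWordsL a b j ≡ nWords a b j
nWordsL-noFlaw a b j b≤a rewrite <ᵇ-false b≤a = refl

onlyL-flawless : ∀ a → nWords a 0 0 ≡ 1
onlyL-flawless zero    = refl
onlyL-flawless (suc a) = trans (nWordsL-noFlaw a 0 0 z≤n) (onlyL-flawless a)

onlyL-flawed : ∀ a j → nWords a 0 (suc j) ≡ 0
onlyL-flawed zero    j = refl
onlyL-flawed (suc a) j = trans (nWordsL-noFlaw a 0 (suc j) z≤n) (onlyL-flawed a j)

onlyR-flawless : ∀ b → nWords 0 b 0 ≡ 1
onlyR-flawless zero    = refl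
onlyR-flawless (suc b) = onlyR-flawless b

-- Every flaw is an L, so a word has at most a flaws.
tooManyFlaws : ∀ a b j → a < j → nWords a b j ≡ 0
tooManyFlaws zero    zero    (suc j) _   = refl
tooManyFlaws zero    (suc b) j       a<j = tooManyFlaws zero b j a<j
tooManyFlaws (suc a) zero    j       a<j =
  trans (nWordsL-noFlaw a 0 j z≤n) (tooManyFlaws a 0 j (<-trans (n<1+n a) a<j))
tooManyFlaws (suc a) (suc b) j       a<j =
  cong₂ _+_ (tooManyFlawsL j a<j) (tooManyFlaws (suc a) b j a<j)
  where
  tooManyFlawsL : ∀ j → suc a < j → nWordsL a (suc b) j ≡ 0
  tooManyFlawsL j a<j with a <? suc b
  tooManyFlawsL (suc j) (s≤s a<j) | yes a<b = trans (nWordsL-flaw a (suc b) j a<b) (tooManyFlaws a (suc b) j a<j)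
  ... | no a≮b = trans (nWordsL-noFlaw a (suc b) j (≮⇒≥ a≮b)) (tooManyFlaws a (suc b) j (<-trans (n<1+n a) a<j))

catalan : ℕ → ℕ
catalan n = nWords n n 0

ballot : ℕ → ℕ → ℕ
ballot d u = nWords (d + u) u 0

-- Ballot numbers start at 1 and satisfy the last-letter recurrence; on
-- the diagonal a final L would be a flaw, so the word must end in R.
ballot-0 : ∀ d → ballot d 0 ≡ 1
ballot-0 d = onlyL-flawless (d + 0)

ballot-diag : ∀ u → ballot 0 (suc u) ≡ ballot 1 u
ballot-diag u = cong (_+ nWords (suc u) u 0) (nWordsL-flaw₀ u (suc u) (n<1+n u))

ballot-step : ∀ d u → ballot (suc d) (suc u) ≡ ballot d (suc u) + ballot (suc (suc d)) u
ballot-step d u = cong₂ _+_ (nWordsL-noFlaw (d + suc u) (suc u) 0 (m≤n+m (suc u) d))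
                            (cong (λ x → nWords (suc x) u 0) (+-suc d u))

keepIf : Bool → ℕ → ℕ
keepIf true  x = x
keepIf false x = 0

catalanFrom : ℕ → ℕ → ℕ
catalanFrom j m = keepIf (j ≤ᵇ m) (catalan m)

ballotUpTo : ℕ → ℕ → ℕ → ℕ
ballotUpTo d j u = keepIf (u <ᵇ suc j) (ballot d u)

catalanFrom-yes : ∀ j m → j ≤ m → catalanFrom j m ≡ catalan m
catalanFrom-yes j m j≤m rewrite ≤ᵇ-true j≤m = refl

catalanFrom-no : ∀ j m → m < j → catalanFrom j m ≡ 0
catalanFrom-no j m m<j rewrite ≤ᵇ-false m<j = refl

keepIf-split : ∀ m j x → keepIf (m <ᵇ suc j) x + keepIf (j <ᵇ m) x ≡ x
keepIf-split m j x with m ≤? j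
... | yes m≤j rewrite <ᵇ-true (s≤s m≤j) | <ᵇ-false m≤j = +-identityʳ x
... | no  m≰j rewrite <ᵇ-false (≰⇒> m≰j) | <ᵇ-true (≰⇒> m≰j) = refl

ballotUpTo-diag : ∀ j u → ballotUpTo 0 (suc j) (suc u) ≡ ballotUpTo 1 j u
ballotUpTo-diag j u = cong (keepIf (u <ᵇ suc j)) (ballot-diag u)

ballotUpTo-step : ∀ d j u →
  ballotUpTo (suc d) (suc j) (suc u) ≡ ballotUpTo d (suc j) (suc u) + ballotUpTo (suc (suc d)) j u
ballotUpTo-step d j u with u <ᵇ suc j
... | true  = ballot-step d u
... | false = refl

ballotUpTo-0 : ∀ d d′ u → ballotUpTo d 0 u ≡ ballotUpTo d′ 0 u
ballotUpTo-0 d d′ zero    = trans (ballot-0 d) (sym (ballot-0 d′))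
ballotUpTo-0 d d′ (suc u) = refl

-- Last-letter decompositions used by the Chung–Feller recursion.  With
-- more L's than R's, appending L is never a flaw; with more R's than L's
-- it always is.
leftExcess-unfold : ∀ b j d →
  nWords (suc (d + suc b)) (suc b) j ≡ nWords (d + suc b) (suc b) j + nWords (suc (suc d + b)) b j
leftExcess-unfold b j d = cong₂ _+_ (nWordsL-noFlaw (d + suc b) (suc b) j (m≤n+m (suc b) d))
                                    (cong (λ x → nWords (suc x) b j) (+-suc d b))

rightExcess-unfold : ∀ a j d →
  nWords (suc a) (suc (d + suc a)) (suc j) ≡ nWords a (suc (suc d + a)) j + nWords (suc a) (d + suc a) (suc j)
rightExcess-unfold a j d =
  cong (_+ nWords (suc a) (d + suc a) (suc j))
       (trans (nWordsL-flaw a _ j (s≤s (≤-trans (n≤1+n a) (m≤n+m (suc a) d))))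
              (cong (λ x → nWords a (suc x) j) (+-suc d a)))

rightExcess-unfold₀ : ∀ a d → nWords (suc a) (suc (d + suc a)) 0 ≡ nWords (suc a) (d + suc a) 0
rightExcess-unfold₀ a d =
  cong (_+ nWords (suc a) (d + suc a) 0) (nWordsL-flaw₀ a _ (s≤s (≤-trans (n≤1+n a) (m≤n+m (suc a) d))))

-- The case j = 0 of `rightExcess` below, which needs no Chung–Feller:
-- only the term i = a of the convolution survives, so the flawless words
-- with a L's and more R's number catalan a.
rightExcess-flawless : ∀ a d → nWords a (suc (d + a)) 0 ≡ conv catalan (ballotUpTo d 0) a
rightExcess-flawless zero    d       = trans (onlyR-flawless (suc (d + 0))) (sym (trans (+-identityʳ _) (ballot-0 d)))
rightExcess-flawless (suc a) zero    = begin
  nWords (suc a) (suc (suc a)) 0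
    ≡⟨ rightExcess-unfold₀ a 0 ⟩
  catalan (suc a)
    ≡⟨ sym (trans (cong (catalan (suc a) +_) (conv-zeroʳ catalan a)) (+-identityʳ _)) ⟩
  catalan (suc a) + conv catalan (λ _ → 0) a
    ≡⟨ sym (conv-peel catalan (ballotUpTo 0 0) (λ _ → 0) a (ballot-0 0) (λ _ → refl)) ⟩
  conv catalan (ballotUpTo 0 0) (suc a) ∎
rightExcess-flawless (suc a) (suc d) = begin
  nWords (suc a) (suc (suc d + suc a)) 0
    ≡⟨ rightExcess-unfold₀ a (suc d) ⟩
  nWords (suc a) (suc (d + suc a)) 0
    ≡⟨ rightExcess-flawless (suc a) d ⟩
  conv catalan (ballotUpTo d 0) (suc a)
    ≡⟨ conv-cong {catalan} (suc a) (λ _ → refl) (ballotUpTo-0 d (suc d)) ⟩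
  conv catalan (ballotUpTo (suc d) 0) (suc a) ∎

-- The Chung–Feller theorem, proved together with two convolution
-- formulas for unbalanced words (decomposition at the last return to
-- the diagonal):
--   leftExcess  : words with d+1 more L's than R's,
--   rightExcess : words with d+1 more R's than L's,
--   chungFeller : a balanced word of length 2n has j flaws for exactly
--                 catalan n words, whatever j ≤ n.
mutual
  leftExcess : ∀ b j d → nWords (suc (d + b)) b j ≡ conv (catalanFrom j) (ballot d) b
  leftExcess zero    zero    d = trans (onlyL-flawless (suc (d + 0))) (sym (trans (+-identityʳ _) (ballot-0 d)))
  leftExcess zero    (suc j) d = onlyL-flawed (suc (d + 0)) j
  leftExcess (suc b) j zero = begin
    nWords (suc (suc b)) (suc b) j
      ≡⟨ leftExcess-unfold b j 0 ⟩
    nWords (suc b) (suc b) j + nWords (suc (suc b)) b j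
      ≡⟨ cong₂ _+_ (diagonal (suc b) j) (leftExcess b j 1) ⟩
    catalanFrom j (suc b) + conv (catalanFrom j) (ballot 1) b
      ≡⟨ sym (conv-peel (catalanFrom j) (ballot 0) (ballot 1) b (ballot-0 0) ballot-diag) ⟩
    conv (catalanFrom j) (ballot 0) (suc b) ∎
  leftExcess (suc b) j (suc d) = begin
    nWords (suc (suc d + suc b)) (suc b) j
      ≡⟨ leftExcess-unfold b j (suc d) ⟩
    nWords (suc (d + suc b)) (suc b) j + nWords (suc (suc (suc d) + b)) b j
      ≡⟨ cong₂ _+_ (leftExcess (suc b) j d) (leftExcess b j (suc (suc d))) ⟩
    conv (catalanFrom j) (ballot d) (suc b) + conv (catalanFrom j) (ballot (suc (suc d))) b
      ≡⟨ sym (conv-split (catalanFrom j) (ballot (suc d)) (ballot d) (ballot (suc (suc d))) b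
                         (trans (ballot-0 (suc d)) (sym (ballot-0 d))) (ballot-step d)) ⟩
    conv (catalanFrom j) (ballot (suc d)) (suc b) ∎

  rightExcess : ∀ a j d → j ≤ a → nWords a (suc (d + a)) j ≡ conv catalan (ballotUpTo d j) a
  rightExcess a zero d _ = rightExcess-flawless a d
  rightExcess (suc a) (suc j) zero (s≤s j≤a) = begin
    nWords (suc a) (suc (suc a)) (suc j)
      ≡⟨ rightExcess-unfold a j 0 ⟩
    nWords a (suc (suc a)) j + nWords (suc a) (suc a) (suc j)
      ≡⟨ +-comm (nWords a (suc (suc a)) j) _ ⟩
    nWords (suc a) (suc a) (suc j) + nWords a (suc (suc a)) j
      ≡⟨ cong₂ _+_ (chungFeller (suc a) (suc j) (s≤s j≤a)) (rightExcess a j 1 j≤a) ⟩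
    catalan (suc a) + conv catalan (ballotUpTo 1 j) a
      ≡⟨ sym (conv-peel catalan (ballotUpTo 0 (suc j)) (ballotUpTo 1 j) a (ballot-0 0) (ballotUpTo-diag j)) ⟩
    conv catalan (ballotUpTo 0 (suc j)) (suc a) ∎
  rightExcess (suc a) (suc j) (suc d) (s≤s j≤a) = begin
    nWords (suc a) (suc (suc d + suc a)) (suc j)
      ≡⟨ rightExcess-unfold a j (suc d) ⟩
    nWords a (suc (suc (suc d) + a)) j + nWords (suc a) (suc (d + suc a)) (suc j)
      ≡⟨ +-comm (nWords a (suc (suc (suc d) + a)) j) _ ⟩
    nWords (suc a) (suc (d + suc a)) (suc j) + nWords a (suc (suc (suc d) + a)) j
      ≡⟨ cong₂ _+_ (rightExcess (suc a) (suc j) d (s≤s j≤a)) (rightExcess a j (suc (suc d)) j≤a) ⟩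
    conv catalan (ballotUpTo d (suc j)) (suc a) + conv catalan (ballotUpTo (suc (suc d)) j) a
      ≡⟨ sym (conv-split catalan (ballotUpTo (suc d) (suc j)) (ballotUpTo d (suc j)) (ballotUpTo (suc (suc d)) j) a
                         (trans (ballot-0 (suc d)) (sym (ballot-0 d))) (ballotUpTo-step d j)) ⟩
    conv catalan (ballotUpTo (suc d) (suc j)) (suc a) ∎

  chungFeller : ∀ n j → j ≤ n → nWords n n j ≡ catalan n
  chungFeller zero    zero    _ = refl
  chungFeller (suc n) zero    _ = refl
  chungFeller (suc n) (suc j) (s≤s j≤n) = begin
    nWordsL n (suc n) (suc j) + nWords (suc n) n (suc j)
      ≡⟨ cong₂ _+_ (nWordsL-flaw n (suc n) j (n<1+n n)) (leftExcess n (suc j) 0) ⟩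
    nWords n (suc n) j + conv (catalanFrom (suc j)) catalan n
      ≡⟨ cong (_+ conv (catalanFrom (suc j)) catalan n) (trans (rightExcess n j 0 j≤n) (conv-comm catalan _ n)) ⟩
    conv (ballotUpTo 0 j) catalan n + conv (catalanFrom (suc j)) catalan n
      ≡⟨ sym (conv-+ˡ (ballotUpTo 0 j) (catalanFrom (suc j)) catalan n) ⟩
    conv (λ m → ballotUpTo 0 j m + catalanFrom (suc j) m) catalan n
      ≡⟨ conv-cong n (λ m → keepIf-split m j (catalan m)) (λ _ → refl) ⟩
    conv catalan catalan n
      ≡⟨ sym (leftExcess n 0 0) ⟩
    nWords (suc n) n 0
      ≡⟨ cong (_+ nWords (suc n) n 0) (sym (nWordsL-flaw₀ n (suc n) (n<1+n n))) ⟩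
    nWordsL n (suc n) 0 + nWords (suc n) n 0 ∎

  diagonal : ∀ m j → nWords m m j ≡ catalanFrom j m
  diagonal m j with j ≤? m
  ... | yes j≤m = trans (chungFeller m j j≤m) (sym (catalanFrom-yes j m j≤m))
  ... | no  j≰m = trans (tooManyFlaws m m j (≰⇒> j≰m)) (sym (catalanFrom-no j m (≰⇒> j≰m)))

allWords : ∀ a b → Σ≤ a (nWords a b) ≡ binom (a + b) a
allWords zero    b    = onlyR-flawless b
allWords (suc a) zero = begin
  nWords (suc a) 0 0 + Σ≤ a (λ i → nWords (suc a) 0 (suc i))
    ≡⟨ cong₂ _+_ (onlyL-flawless (suc a)) (Σ≤-zero a _ (onlyL-flawed (suc a))) ⟩
  1
    ≡⟨ sym (trans (cong (λ x → binom x (suc a)) (+-identityʳ (suc a))) (binom-diag (suc a))) ⟩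
  binom (suc a + 0) (suc a) ∎
allWords (suc a) (suc b) = begin
  Σ≤ (suc a) (λ j → nWordsL a (suc b) j + nWords (suc a) b j)
    ≡⟨ Σ≤-+ (suc a) (nWordsL a (suc b)) (nWords (suc a) b) ⟩
  Σ≤ (suc a) (nWordsL a (suc b)) + Σ≤ (suc a) (nWords (suc a) b)
    ≡⟨ cong₂ _+_ (allWordsL (a <? suc b))
                 (trans (allWords (suc a) b) (cong (λ x → binom x (suc a)) (sym (+-suc a b)))) ⟩
  binom (a + suc b) a + binom (a + suc b) (suc a) ∎
  where
  -- Words ending in L are counted through their prefixes; when the final L
  -- is a flaw, the flaw count is shifted by one.
  allWordsL : Dec (a < suc b) → Σ≤ (suc a) (nWordsL a (suc b)) ≡ binom (a + suc b) a
  allWordsL (yes a<b) =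
    trans (cong₂ _+_ (nWordsL-flaw₀ a (suc b) a<b) (Σ≤-cong a (λ i _ → nWordsL-flaw a (suc b) i a<b)))
          (allWords a (suc b))
  allWordsL (no a≮b) = begin
    Σ≤ (suc a) (nWordsL a (suc b))
      ≡⟨ Σ≤-cong (suc a) (λ i _ → nWordsL-noFlaw a (suc b) i (≮⇒≥ a≮b)) ⟩
    Σ≤ (suc a) (nWords a (suc b))
      ≡⟨ Σ≤-last a (nWords a (suc b)) ⟩
    Σ≤ a (nWords a (suc b)) + nWords a (suc b) (suc a)
      ≡⟨ cong₂ _+_ (allWords a (suc b)) (tooManyFlaws a (suc b) (suc a) (n<1+n a)) ⟩
    binom (a + suc b) a + 0
      ≡⟨ +-identityʳ _ ⟩
    binom (a + suc b) a ∎

-- (n+1)·catalan n = C(2n,n): the n+1 flaw classes of balanced words are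
-- equinumerous by Chung–Feller.
catalan-binom : ∀ n → suc n * catalan n ≡ binom (2 * n) n
catalan-binom n = begin
  suc n * catalan n          ≡⟨ sym (Σ≤-const n (catalan n)) ⟩
  Σ≤ n (λ _ → catalan n)     ≡⟨ Σ≤-cong n (λ j j≤n → sym (chungFeller n j j≤n)) ⟩
  Σ≤ n (nWords n n)          ≡⟨ allWords n n ⟩
  binom (n + n) n            ≡⟨ cong (λ x → binom (n + x) n) (sym (+-identityʳ n)) ⟩
  binom (2 * n) n            ∎

-- nSupersets n j k : the number of k-element subsets of an n-element set
-- containing a fixed j-element subset, i.e. C(n-j, k-j).
nSupersets : ℕ → ℕ → ℕ → ℕ
nSupersets n       zero    k       = binom n k
nSupersets zero    (suc j) k       = 0
nSupersets (suc n) (suc j) zero    = 0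
nSupersets (suc n) (suc j) (suc k) = nSupersets n j k

-- Pascal's rule for supersets: a new point outside the fixed subset is
-- either left out or put in.
nSupersets-new₀ : ∀ n j → j ≤ n → nSupersets (suc n) j 0 ≡ nSupersets n j 0
nSupersets-new₀ n       zero    _ = refl
nSupersets-new₀ (suc n) (suc j) _ = refl

nSupersets-new : ∀ n j k → j ≤ n → nSupersets (suc n) j (suc k) ≡ nSupersets n j (suc k) + nSupersets n j k
nSupersets-new n       zero    k       _         = +-comm (binom n k) (binom n (suc k))
nSupersets-new (suc n) (suc j) zero    (s≤s j≤n) = trans (nSupersets-new₀ n j j≤n) (sym (+-identityʳ _))
nSupersets-new (suc n) (suc j) (suc k) (s≤s j≤n) = nSupersets-new n j k j≤n

hockeyStick : ∀ n k → k ≤ n → Σ≤ n (λ j → nSupersets n j k) ≡ binom (suc n) k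
hockeyStick zero    zero    _         = refl
hockeyStick (suc n) zero    _         = cong (1 +_) (Σ≤-zero n _ (λ _ → refl))
hockeyStick (suc n) (suc k) (s≤s k≤n) =
  trans (cong (binom (suc n) (suc k) +_) (hockeyStick n k k≤n)) (+-comm (binom (suc n) (suc k)) _)

countIdentity : ∀ n k → k ≤ n →
  (n + 1 ∸ k) * Σ≤ n (λ j → nWords n n j * nSupersets n j k) ≡ (n C k) * ((2 * n) C n)
countIdentity n k k≤n = begin
  (n + 1 ∸ k) * Σ≤ n (λ j → nWords n n j * nSupersets n j k)
    ≡⟨ cong₂ (λ u v → (u ∸ k) * v) (+-comm n 1) (Σ≤-cong n (λ j j≤n → cong (_* nSupersets n j k) (chungFeller n j j≤n))) ⟩
  (suc n ∸ k) * Σ≤ n (λ j → catalan n * nSupersets n j k)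
    ≡⟨ cong ((suc n ∸ k) *_) (trans (Σ≤-*ˡ n (catalan n) (λ j → nSupersets n j k)) (cong (catalan n *_) (hockeyStick n k k≤n))) ⟩
  (suc n ∸ k) * (catalan n * binom (suc n) k)
    ≡⟨ *-swapˡ (suc n ∸ k) (catalan n) (binom (suc n) k) ⟩
  catalan n * ((suc n ∸ k) * binom (suc n) k)
    ≡⟨ cong (catalan n *_) (binom-complement n k k≤n) ⟩
  catalan n * (suc n * binom n k)
    ≡⟨ *-swapˡ (catalan n) (suc n) (binom n k) ⟩
  suc n * (catalan n * binom n k)
    ≡⟨ sym (*-assoc (suc n) (catalan n) (binom n k)) ⟩
  (suc n * catalan n) * binom n k
    ≡⟨ cong₂ _*_ (catalan-binom n) (binom≡C n k) ⟩
  binom (2 * n) n * (n C k)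
    ≡⟨ cong (_* (n C k)) (binom≡C (2 * n) n) ⟩
  ((2 * n) C n) * (n C k)
    ≡⟨ *-comm ((2 * n) C n) (n C k) ⟩
  (n C k) * ((2 * n) C n) ∎

empty↔ : ∀ {A : Set} → (A → ⊥) → Fin 0 ↔ A
empty↔ ¬a = mk↔ₛ′ (λ ()) (λ a → ⊥-elim (¬a a)) (λ a → ⊥-elim (¬a a)) (λ ())

Fin-cong : ∀ {m n} → m ≡ n → Fin m ↔ Fin n
Fin-cong refl = ↔-refl

Σ-bounded↔ : ∀ m {P : ℕ → Set} (f : ℕ → ℕ) →
             (∀ j → Fin (f j) ↔ P j) → (∀ {j} → P j → j ≤ m) → Fin (Σ≤ m f) ↔ Σ ℕ P
Σ-bounded↔ zero {P} f fibre bound = ↔-trans (fibre 0) (mk↔ₛ′ (0 ,_) from to∘from (λ _ → refl))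
  where
  from : Σ ℕ P → P 0
  from (zero  , x) = x
  from (suc j , x) with () ← bound x
  to∘from : ∀ p → (0 , from p) ≡ p
  to∘from (zero  , x) = refl
  to∘from (suc j , x) with () ← bound x
Σ-bounded↔ (suc m) {P} f fibre bound =
  ↔-trans +↔⊎ (↔-trans (fibre 0 ⊎-↔ Σ-bounded↔ m (λ j → f (suc j)) (λ j → fibre (suc j)) (λ x → ≤-pred (bound x)))
                       (mk↔ₛ′ join split join∘split (λ { (inj₁ _) → refl ; (inj₂ _) → refl })))
  where
  join : P 0 ⊎ Σ ℕ (λ j → P (suc j)) → Σ ℕ P
  join (inj₁ x)       = 0 , x
  join (inj₂ (j , x)) = suc j , x
  split : Σ ℕ P → P 0 ⊎ Σ ℕ (λ j → P (suc j))
  split (zero  , x) = inj₁ x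
  split (suc j , x) = inj₂ (j , x)
  join∘split : ∀ p → join (split p) ≡ p
  join∘split (zero  , x) = refl
  join∘split (suc j , x) = refl

-- The words counted by `nWords`, as an inductive family: `Word a b j`
-- has a L's, b R's and j flaws, and `LastL a b j` consists of the words
-- with a+1 L's ending in L (the final L being a flaw exactly when a < b).
mutual
  data Word : ℕ → ℕ → ℕ → Set where
    ε : Word 0 0 0
    L : ∀ {a b j} → LastL a b j → Word (suc a) b j
    R : ∀ {a b j} → Word a b j → Word a (suc b) j

  data LastL (a b : ℕ) : ℕ → Set where
    flawL   : ∀ {j} → .(a < b) → Word a b j → LastL a b (suc j)
    noFlawL : ∀ {j} → .(b ≤ a) → Word a b j → LastL a b j

mutual
  Word↔ : ∀ a b j → Fin (nWords a b j) ↔ Word a b j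
  Word↔ zero    zero    zero    = mk↔ₛ′ (λ _ → ε) (λ _ → Fin.zero) (λ { ε → refl }) (λ { Fin.zero → refl ; (Fin.suc ()) })
  Word↔ zero    zero    (suc j) = empty↔ (λ ())
  Word↔ zero    (suc b) j       = ↔-trans (Word↔ zero b j) (mk↔ₛ′ R (λ { (R w) → w }) (λ { (R w) → refl }) (λ _ → refl))
  Word↔ (suc a) zero    j       = ↔-trans (LastL↔ a zero j) (mk↔ₛ′ L (λ { (L x) → x }) (λ { (L x) → refl }) (λ _ → refl))
  Word↔ (suc a) (suc b) j       = ↔-trans +↔⊎ (↔-trans (LastL↔ a (suc b) j ⊎-↔ Word↔ (suc a) b j)
    (mk↔ₛ′ (λ { (inj₁ x) → L x ; (inj₂ w) → R w }) (λ { (L x) → inj₁ x ; (R w) → inj₂ w })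
           (λ { (L x) → refl ; (R w) → refl }) (λ { (inj₁ x) → refl ; (inj₂ w) → refl })))

  LastL↔ : ∀ a b j → Fin (nWordsL a b j) ↔ LastL a b j
  LastL↔ a b j = LastL↔-by (a <? b) j

  LastL↔-by : ∀ {a b} → Dec (a < b) → ∀ j → Fin (nWordsL a b j) ↔ LastL a b j
  LastL↔-by {a} {b} (yes a<b) zero = ↔-trans (Fin-cong (nWordsL-flaw₀ a b a<b))
    (empty↔ λ { (noFlawL b≤a _) → ⊥-elim-irr (<⇒≱ a<b b≤a) })
  LastL↔-by {a} {b} (yes a<b) (suc j) = ↔-trans (Fin-cong (nWordsL-flaw a b j a<b)) (↔-trans (Word↔ a b j)
    (mk↔ₛ′ (flawL a<b) (λ { (flawL _ w) → w ; (noFlawL b≤a _) → ⊥-elim-irr (<⇒≱ a<b b≤a) })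
           (λ { (flawL _ w) → refl ; (noFlawL b≤a _) → ⊥-elim-irr (<⇒≱ a<b b≤a) }) (λ _ → refl)))
  LastL↔-by {a} {b} (no a≮b) j = ↔-trans (Fin-cong (nWordsL-noFlaw a b j (≮⇒≥ a≮b))) (↔-trans (Word↔ a b j)
    (mk↔ₛ′ (noFlawL (≮⇒≥ a≮b)) (λ { (noFlawL _ w) → w ; (flawL a<b _) → ⊥-elim-irr (a≮b a<b) })
           (λ { (noFlawL _ w) → refl ; (flawL a<b _) → ⊥-elim-irr (a≮b a<b) }) (λ _ → refl)))

flaws≤ : ∀ {a b j} → Word a b j → j ≤ a
flaws≤ ε                   = z≤n
flaws≤ (L (flawL _ w))     = s≤s (flaws≤ w)
flaws≤ (L (noFlawL _ w))   = ≤-trans (flaws≤ w) (n≤1+n _)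
flaws≤ (R w)               = flaws≤ w

∈-∷ʳ⁻ : ∀ {A : Set} {n} {z x : A} (xs : Vec A n) → z ∈ xs ∷ʳ x → z ∈ xs ⊎ z ≡ x
∈-∷ʳ⁻ []       (here z≡x) = inj₂ z≡x
∈-∷ʳ⁻ (y ∷ xs) (here z≡y) = inj₁ (here z≡y)
∈-∷ʳ⁻ (y ∷ xs) (there z∈) with ∈-∷ʳ⁻ xs z∈
... | inj₁ z∈xs = inj₁ (there z∈xs)
... | inj₂ z≡x  = inj₂ z≡x

∈-∷ʳ⁺ˡ : ∀ {A : Set} {n} {z x : A} {xs : Vec A n} → z ∈ xs → z ∈ xs ∷ʳ x
∈-∷ʳ⁺ˡ (here z≡y) = here z≡y
∈-∷ʳ⁺ˡ (there z∈) = there (∈-∷ʳ⁺ˡ z∈)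

∈-∷ʳ⁺ʳ : ∀ {A : Set} {n} {x : A} (xs : Vec A n) → x ∈ xs ∷ʳ x
∈-∷ʳ⁺ʳ []       = here refl
∈-∷ʳ⁺ʳ (y ∷ xs) = there (∈-∷ʳ⁺ʳ xs)

Below : ℕ → ∀ {k} → Vec ℕ k → Set
Below M v = ∀ {z} → z ∈ v → z < M

Increasing : ∀ {n} → Vec ℕ n → Set
Increasing []       = ⊤
Increasing (x ∷ xs) = (∀ {z} → z ∈ xs → x < z) × Increasing xs

Increasing-∷ʳ : ∀ {n} (xs : Vec ℕ n) x → Increasing xs → Below x xs → Increasing (xs ∷ʳ x)
Increasing-∷ʳ []       x _             _    = (λ ()) , tt
Increasing-∷ʳ (y ∷ xs) x (y<xs , incr) xs<x = y<xs∷ʳx , Increasing-∷ʳ xs x incr (λ z∈ → xs<x (there z∈))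
  where
  y<xs∷ʳx : ∀ {z} → z ∈ xs ∷ʳ x → y < z
  y<xs∷ʳx z∈ with ∈-∷ʳ⁻ xs z∈
  ... | inj₁ z∈xs = y<xs z∈xs
  ... | inj₂ refl = xs<x (here refl)

Increasing-init : ∀ {n} (xs : Vec ℕ n) x → Increasing (xs ∷ʳ x) → Increasing xs × Below x xs
Increasing-init []       x _             = tt , λ ()
Increasing-init (y ∷ xs) x (y<xs , incr) with Increasing-init xs x incr
... | incr′ , xs<x = ((λ z∈ → y<xs (∈-∷ʳ⁺ˡ z∈)) , incr′) , y∷xs<x
  where
  y∷xs<x : Below x (y ∷ xs)
  y∷xs<x (here refl) = y<xs (∈-∷ʳ⁺ʳ xs)
  y∷xs<x (there z∈)  = xs<x z∈

record ColumnPair {a b : ℕ} (m : ℕ) (Ls : Vec ℕ a) (Rs : Vec ℕ b) : Set where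
  field
    increasingL : Increasing Ls
    increasingR : Increasing Rs
    boundedL    : Below m Ls
    boundedR    : Below m Rs
    covers      : ∀ z → z < m → z ∈ Ls ⊎ z ∈ Rs
    disjoint    : ∀ {z} → z ∈ Ls → z ∈ Rs → ⊥
open ColumnPair

ColumnPair-swap : ∀ {a b m} {Ls : Vec ℕ a} {Rs : Vec ℕ b} → ColumnPair m Ls Rs → ColumnPair m Rs Ls
ColumnPair-swap cp = record
  { increasingL = increasingR cp ; increasingR = increasingL cp
  ; boundedL = boundedR cp ; boundedR = boundedL cp
  ; covers = λ z z<m → swap (covers cp z z<m) ; disjoint = λ z∈Rs z∈Ls → disjoint cp z∈Ls z∈Rs }
  where
  swap : ∀ {A B : Set} → A ⊎ B → B ⊎ A
  swap (inj₁ x) = inj₂ x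
  swap (inj₂ y) = inj₁ y

ColumnPair-pushL : ∀ {a b m} {Ls : Vec ℕ a} {Rs : Vec ℕ b} → ColumnPair m Ls Rs → ColumnPair (suc m) (Ls ∷ʳ m) Rs
ColumnPair-pushL {m = m} {Ls} {Rs} cp = record
  { increasingL = Increasing-∷ʳ Ls m (increasingL cp) (boundedL cp)
  ; increasingR = increasingR cp
  ; boundedL    = bounded
  ; boundedR    = λ z∈ → m<n⇒m<1+n (boundedR cp z∈)
  ; covers      = cover
  ; disjoint    = disjoint′ }
  where
  bounded : Below (suc m) (Ls ∷ʳ m)
  bounded z∈ with ∈-∷ʳ⁻ Ls z∈
  ... | inj₁ z∈Ls = m<n⇒m<1+n (boundedL cp z∈Ls)
  ... | inj₂ refl = n<1+n m
  cover : ∀ z → z < suc m → z ∈ Ls ∷ʳ m ⊎ z ∈ Rs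
  cover z z<1+m with m≤n⇒m<n∨m≡n (≤-pred z<1+m)
  ... | inj₂ refl = inj₁ (∈-∷ʳ⁺ʳ Ls)
  ... | inj₁ z<m with covers cp z z<m
  ...   | inj₁ z∈Ls = inj₁ (∈-∷ʳ⁺ˡ z∈Ls)
  ...   | inj₂ z∈Rs = inj₂ z∈Rs
  disjoint′ : ∀ {z} → z ∈ Ls ∷ʳ m → z ∈ Rs → ⊥
  disjoint′ z∈ z∈Rs with ∈-∷ʳ⁻ Ls z∈
  ... | inj₁ z∈Ls = disjoint cp z∈Ls z∈Rs
  ... | inj₂ refl = <-irrefl refl (boundedR cp z∈Rs)

ColumnPair-pushR : ∀ {a b m} {Ls : Vec ℕ a} {Rs : Vec ℕ b} → ColumnPair m Ls Rs → ColumnPair (suc m) Ls (Rs ∷ʳ m)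
ColumnPair-pushR cp = ColumnPair-swap (ColumnPair-pushL (ColumnPair-swap cp))

ColumnPair-popL : ∀ {a b m} (Ls : Vec ℕ (suc a)) {Rs : Vec ℕ b} → ColumnPair (suc m) Ls Rs → m ∈ Ls →
                  Σ (Vec ℕ a) λ Ls′ → Ls ≡ Ls′ ∷ʳ m × ColumnPair m Ls′ Rs
ColumnPair-popL {m = m} Ls {Rs} cp m∈Ls with initLast Ls
... | Ls′ , x , refl = Ls′ , cong (Ls′ ∷ʳ_) x≡m , record
  { increasingL = proj₁ init
  ; increasingR = increasingR cp
  ; boundedL    = λ z∈ → subst (_ <_) x≡m (proj₂ init z∈)
  ; boundedR    = boundedBelow
  ; covers      = cover
  ; disjoint    = λ z∈Ls′ z∈Rs → disjoint cp (∈-∷ʳ⁺ˡ z∈Ls′) z∈Rs }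
  where
  init = Increasing-init Ls′ x (increasingL cp)
  x≡m : x ≡ m
  x≡m with ∈-∷ʳ⁻ Ls′ m∈Ls
  ... | inj₁ m∈Ls′ = ⊥-elim (<⇒≱ (proj₂ init m∈Ls′) (≤-pred (boundedL cp (∈-∷ʳ⁺ʳ Ls′))))
  ... | inj₂ m≡x   = sym m≡x
  boundedBelow : Below m Rs
  boundedBelow z∈Rs with m≤n⇒m<n∨m≡n (≤-pred (boundedR cp z∈Rs))
  ... | inj₁ z<m  = z<m
  ... | inj₂ refl = ⊥-elim (disjoint cp m∈Ls z∈Rs)
  cover : ∀ z → z < m → z ∈ Ls′ ⊎ z ∈ Rs
  cover z z<m with covers cp z (m<n⇒m<1+n z<m)
  ... | inj₂ z∈Rs = inj₂ z∈Rs
  ... | inj₁ z∈Ls with ∈-∷ʳ⁻ Ls′ z∈Ls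
  ...   | inj₁ z∈Ls′ = inj₁ z∈Ls′
  ...   | inj₂ refl  = ⊥-elim (<-irrefl x≡m z<m)

ColumnPair-popR : ∀ {a b m} {Ls : Vec ℕ a} (Rs : Vec ℕ (suc b)) → ColumnPair (suc m) Ls Rs → m ∈ Rs →
                  Σ (Vec ℕ b) λ Rs′ → Rs ≡ Rs′ ∷ʳ m × ColumnPair m Ls Rs′
ColumnPair-popR Rs cp m∈Rs with ColumnPair-popL Rs (ColumnPair-swap cp) m∈Rs
... | Rs′ , Rs≡ , cp′ = Rs′ , Rs≡ , ColumnPair-swap cp′

mutual
  columns : ∀ {a b j} → Word a b j → Vec ℕ a × Vec ℕ b
  columns ε             = [] , []
  columns (L {a} {b} x) = proj₁ (columnsL x) ∷ʳ (a + b) , proj₂ (columnsL x)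
  columns (R {a} {b} w) = proj₁ (columns w) , proj₂ (columns w) ∷ʳ (a + b)

  columnsL : ∀ {a b j} → LastL a b j → Vec ℕ a × Vec ℕ b
  columnsL (flawL _ w)   = columns w
  columnsL (noFlawL _ w) = columns w

mutual
  columns-pair : ∀ {a b j} (w : Word a b j) → ColumnPair (a + b) (proj₁ (columns w)) (proj₂ (columns w))
  columns-pair ε = record
    { increasingL = tt ; increasingR = tt ; boundedL = λ () ; boundedR = λ () ; covers = λ _ () ; disjoint = λ () }
  columns-pair (L x)         = ColumnPair-pushL (columnsL-pair x)
  columns-pair (R {a} {b} w) =
    subst (λ m → ColumnPair m (proj₁ (columns w)) (proj₂ (columns w) ∷ʳ (a + b))) (sym (+-suc a b))
          (ColumnPair-pushR (columns-pair w))

  columnsL-pair : ∀ {a b j} (x : LastL a b j) → ColumnPair (a + b) (proj₁ (columnsL x)) (proj₂ (columnsL x))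
  columnsL-pair (flawL _ w)   = columns-pair w
  columnsL-pair (noFlawL _ w) = columns-pair w

appendL : ∀ {a b j} (w : Word a b j) → Σ ℕ λ j′ → Σ (LastL a b j′) λ x → columnsL x ≡ columns w
appendL {a} {b} {j} w with a <? b
... | yes a<b = suc j , flawL a<b w , refl
... | no  a≮b = j , noFlawL (≮⇒≥ a≮b) w , refl

-- Every column pair is read off a word: the largest label is on top of
-- one column; remove it and recurse.
wordOf : ∀ a b (Ls : Vec ℕ a) (Rs : Vec ℕ b) → ColumnPair (a + b) Ls Rs →
         Σ ℕ λ j → Σ (Word a b j) λ w → columns w ≡ (Ls , Rs)
wordOf zero    zero    [] [] _  = 0 , ε , refl
wordOf zero    (suc b) [] Rs cp with covers cp b (n<1+n b)
... | inj₁ ()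
... | inj₂ top∈Rs with ColumnPair-popR Rs cp top∈Rs
...   | Rs′ , refl , cp′ with wordOf zero b [] Rs′ cp′
...     | j , w , w↦ = j , R w , cong (λ c → proj₁ c , proj₂ c ∷ʳ b) w↦
wordOf (suc a) b Ls Rs cp with covers cp (a + b) (n<1+n (a + b))
wordOf (suc a) b Ls Rs cp | inj₁ top∈Ls with ColumnPair-popL Ls cp top∈Ls
... | Ls′ , refl , cp′ with wordOf a b Ls′ Rs cp′
...   | j , w , w↦ with appendL w
...     | j′ , x , x↦ = j′ , L x , cong (λ c → proj₁ c ∷ʳ (a + b) , proj₂ c) (trans x↦ w↦)
wordOf (suc a) zero    Ls [] cp | inj₂ ()
wordOf (suc a) (suc b) Ls Rs cp | inj₂ top∈Rs with ColumnPair-popR Rs cp top∈Rs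
... | Rs′ , refl , cp′ with wordOf (suc a) b Ls Rs′ (subst (λ m → ColumnPair m Ls Rs′) (+-suc a b) cp′)
...   | j , w , w↦ = j , R w , trans (cong (λ c → proj₁ c , proj₂ c ∷ʳ (suc a + b)) w↦)
                                      (cong (λ t → Ls , Rs′ ∷ʳ t) (sym (+-suc a b)))

topNotInL : ∀ {a b j} (w : Word (suc a) b j) → a + suc b ∈ proj₁ (columns w) → ⊥
topNotInL {a} {b} w top∈ = <-irrefl (+-suc a b) (boundedL (columns-pair w) top∈)

mutual
  columns-injective : ∀ {a b j j′} (w : Word a b j) (w′ : Word a b j′) → columns w ≡ columns w′ →
                      _≡_ {A = Σ ℕ (Word a b)} (j , w) (j′ , w′)
  columns-injective ε ε _ = refl
  columns-injective (L x) (L x′) eq with ∷ʳ-injective _ _ (cong proj₁ eq)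
  ... | eqL , _ with columnsL-injective x x′ (cong₂ _,_ eqL (cong proj₂ eq))
  ...   | refl = refl
  columns-injective (R w) (R w′) eq with ∷ʳ-injective _ _ (cong proj₂ eq)
  ... | eqR , _ with columns-injective w w′ (cong₂ _,_ (cong proj₁ eq) eqR)
  ...   | refl = refl
  columns-injective (L {a} {suc b} x) (R w′) eq =
    ⊥-elim (topNotInL w′ (subst (_ ∈_) (cong proj₁ eq) (∈-∷ʳ⁺ʳ (proj₁ (columnsL x)))))
  columns-injective (R w) (L {a} {suc b} x′) eq =
    ⊥-elim (topNotInL w (subst (_ ∈_) (sym (cong proj₁ eq)) (∈-∷ʳ⁺ʳ (proj₁ (columnsL x′)))))

  columnsL-injective : ∀ {a b j j′} (x : LastL a b j) (x′ : LastL a b j′) → columnsL x ≡ columnsL x′ →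
                       _≡_ {A = Σ ℕ (LastL a b)} (j , x) (j′ , x′)
  columnsL-injective (flawL _ w) (flawL _ w′) eq with columns-injective w w′ eq
  ... | refl = refl
  columnsL-injective (noFlawL _ w) (noFlawL _ w′) eq with columns-injective w w′ eq
  ... | refl = refl
  columnsL-injective {a} {b} (flawL a<b _) (noFlawL b≤a _) _ =
    ⊥-elim (<⇒≱ (recompute (a <? b) a<b) (recompute (b ≤? a) b≤a))
  columnsL-injective {a} {b} (noFlawL b≤a _) (flawL a<b _) _ =
    ⊥-elim (<⇒≱ (recompute (a <? b) a<b) (recompute (b ≤? a) b≤a))

bit : Bool → ℕ
bit true  = 1
bit false = 0

badRows : ∀ {a b} → Vec ℕ a → Vec ℕ b → ℕ
badRows (l ∷ ls) (r ∷ rs) = bit (r <ᵇ l) + badRows ls rs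
badRows []       _        = 0
badRows (_ ∷ _)  []       = 0

badRows-[] : ∀ {a} (ls : Vec ℕ a) → badRows ls [] ≡ 0
badRows-[] []      = refl
badRows-[] (_ ∷ _) = refl

-- A new largest label on top of the left column completes a bad row
-- exactly when the right column is already taller (a < b).
badRows-pushL : ∀ {a b} (ls : Vec ℕ a) (rs : Vec ℕ b) x → Below x rs →
                badRows (ls ∷ʳ x) rs ≡ badRows ls rs + bit (a <ᵇ b)
badRows-pushL []       []       x _    = refl
badRows-pushL []       (r ∷ rs) x rs<x rewrite <ᵇ-true (rs<x (here refl)) = refl
badRows-pushL (l ∷ ls) []       x _    = refl
badRows-pushL (l ∷ ls) (r ∷ rs) x rs<x =
  trans (cong (bit (r <ᵇ l) +_) (badRows-pushL ls rs x (λ z∈ → rs<x (there z∈))))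
        (sym (+-assoc (bit (r <ᵇ l)) _ _))

badRows-pushR : ∀ {a b} (ls : Vec ℕ a) (rs : Vec ℕ b) x → Below x ls →
                badRows ls (rs ∷ʳ x) ≡ badRows ls rs
badRows-pushR []       rs       x _    = refl
badRows-pushR (l ∷ ls) []       x ls<x rewrite <ᵇ-false (<⇒≤ (ls<x (here refl))) = badRows-[] ls
badRows-pushR (l ∷ ls) (r ∷ rs) x ls<x = cong (bit (r <ᵇ l) +_) (badRows-pushR ls rs x (λ z∈ → ls<x (there z∈)))

mutual
  columns-flaws : ∀ {a b j} (w : Word a b j) → badRows (proj₁ (columns w)) (proj₂ (columns w)) ≡ j
  columns-flaws ε = refl
  columns-flaws (L x) = columnsL-flaws x
  columns-flaws (R {a} {b} w) =
    trans (badRows-pushR (proj₁ (columns w)) (proj₂ (columns w)) (a + b) (boundedL (columns-pair w)))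
          (columns-flaws w)

  columnsL-flaws : ∀ {a b j} (x : LastL a b j) →
                   badRows (proj₁ (columnsL x) ∷ʳ (a + b)) (proj₂ (columnsL x)) ≡ j
  columnsL-flaws {a} {b} (flawL a<b w) =
    trans (badRows-pushL (proj₁ (columns w)) (proj₂ (columns w)) (a + b) (boundedR (columns-pair w)))
          (trans (cong₂ _+_ (columns-flaws w) (cong bit (<ᵇ-true (recompute (a <? b) a<b)))) (+-comm _ 1))
  columnsL-flaws {a} {b} (noFlawL b≤a w) =
    trans (badRows-pushL (proj₁ (columns w)) (proj₂ (columns w)) (a + b) (boundedR (columns-pair w)))
          (trans (cong₂ _+_ (columns-flaws w) (cong bit (<ᵇ-false (recompute (b ≤? a) b≤a)))) (+-identityʳ _))

pattern leftCol  = Fin.zero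
pattern rightCol = Fin.suc Fin.zero

Increasing⇒lookup< : ∀ {n} (v : Vec ℕ n) → Increasing v → ∀ {i j : Fin n} → i <ᶠ j → lookup v i < lookup v j
Increasing⇒lookup< (x ∷ v) (x<v , _)    {Fin.zero}  {Fin.suc j} _         = x<v (∈-lookup j v)
Increasing⇒lookup< (x ∷ v) (_   , incr) {Fin.suc i} {Fin.suc j} (s≤s i<j) = Increasing⇒lookup< v incr i<j

lookup<⇒Increasing : ∀ {n} (v : Vec ℕ n) → (∀ {i j : Fin n} → i <ᶠ j → lookup v i < lookup v j) → Increasing v
lookup<⇒Increasing []      _    = tt
lookup<⇒Increasing (x ∷ v) mono = x<v , lookup<⇒Increasing v (λ i<j → mono (s≤s i<j))
  where
  x<v : ∀ {z} → z ∈ v → x < z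
  x<v z∈ = subst (x <_) (sym (lookup-index z∈)) (mono {Fin.zero} {Fin.suc (Any.index z∈)} (s≤s z≤n))

Increasing⇒lookup-injective : ∀ {n} (v : Vec ℕ n) → Increasing v → ∀ {i j} → lookup v i ≡ lookup v j → i ≡ j
Increasing⇒lookup-injective v incr {i} {j} eq with <ᶠ-cmp i j
... | tri< i<j _ _ = ⊥-elim (<-irrefl eq (Increasing⇒lookup< v incr i<j))
... | tri≈ _ i≡j _ = i≡j
... | tri> _ _ j<i = ⊥-elim (<-irrefl (sym eq) (Increasing⇒lookup< v incr j<i))

leftColumn rightColumn : ∀ {M n} → Vec (Fin M × Fin M) n → Vec ℕ n
leftColumn  = map (toℕ ∘ proj₁)
rightColumn = map (toℕ ∘ proj₂)

lookup-leftColumn : ∀ {n} (T : Labelling n) i → lookup (leftColumn T) i ≡ toℕ (label T (i , leftCol))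
lookup-leftColumn T i = lookup-map i (toℕ ∘ proj₁) T

lookup-rightColumn : ∀ {n} (T : Labelling n) i → lookup (rightColumn T) i ≡ toℕ (label T (i , rightCol))
lookup-rightColumn T i = lookup-map i (toℕ ∘ proj₂) T

∈leftColumn : ∀ {n z} (T : Labelling n) → z ∈ leftColumn T → Σ (Fin n) λ i → toℕ (label T (i , leftCol)) ≡ z
∈leftColumn T z∈ = Any.index z∈ , trans (sym (lookup-leftColumn T (Any.index z∈))) (sym (lookup-index z∈))

∈rightColumn : ∀ {n z} (T : Labelling n) → z ∈ rightColumn T → Σ (Fin n) λ i → toℕ (label T (i , rightCol)) ≡ z
∈rightColumn T z∈ = Any.index z∈ , trans (sym (lookup-rightColumn T (Any.index z∈))) (sym (lookup-index z∈))

label∈leftColumn : ∀ {n} (T : Labelling n) i → toℕ (label T (i , leftCol)) ∈ leftColumn T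
label∈leftColumn T i = subst (_∈ leftColumn T) (lookup-leftColumn T i) (∈-lookup i (leftColumn T))

label∈rightColumn : ∀ {n} (T : Labelling n) i → toℕ (label T (i , rightCol)) ∈ rightColumn T
label∈rightColumn T i = subst (_∈ rightColumn T) (lookup-rightColumn T i) (∈-lookup i (rightColumn T))

filling⇒ColumnPair : ∀ {n} (T : Labelling n) → IsFilling T × ColumnsIncrease T →
                     ColumnPair (2 * n) (leftColumn T) (rightColumn T)
filling⇒ColumnPair {n} T ((injective , surjective) , increase) = record
  { increasingL = lookup<⇒Increasing (leftColumn T) λ {i} {j} i<j →
      subst₂ _<_ (sym (lookup-leftColumn T i)) (sym (lookup-leftColumn T j)) (increase leftCol i j i<j)
  ; increasingR = lookup<⇒Increasing (rightColumn T) λ {i} {j} i<j →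
      subst₂ _<_ (sym (lookup-rightColumn T i)) (sym (lookup-rightColumn T j)) (increase rightCol i j i<j)
  ; boundedL = λ z∈ → let i , eq = ∈leftColumn T z∈ in subst (_< 2 * n) eq (toℕ<n (label T (i , leftCol)))
  ; boundedR = λ z∈ → let i , eq = ∈rightColumn T z∈ in subst (_< 2 * n) eq (toℕ<n (label T (i , rightCol)))
  ; covers   = cover
  ; disjoint = separate }
  where
  cover : ∀ z → z < 2 * n → z ∈ leftColumn T ⊎ z ∈ rightColumn T
  cover z z<2n with surjective (fromℕ< z<2n)
  ... | (i , leftCol)  , eq = inj₁ (subst (_∈ leftColumn T) (trans (cong toℕ eq) (toℕ-fromℕ< z<2n)) (label∈leftColumn T i))
  ... | (i , rightCol) , eq = inj₂ (subst (_∈ rightColumn T) (trans (cong toℕ eq) (toℕ-fromℕ< z<2n)) (label∈rightColumn T i))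
  separate : ∀ {z} → z ∈ leftColumn T → z ∈ rightColumn T → ⊥
  separate z∈L z∈R with ∈leftColumn T z∈L | ∈rightColumn T z∈R
  ... | i , eqL | i′ , eqR with injective (i , leftCol) (i′ , rightCol) (toℕ-injective (trans eqL (sym eqR)))
  ... | ()

ColumnPair⇒filling : ∀ {n} (T : Labelling n) → ColumnPair (2 * n) (leftColumn T) (rightColumn T) →
                     IsFilling T × ColumnsIncrease T
ColumnPair⇒filling {n} T cp = (injective , surjective) , increase
  where
  increase : ColumnsIncrease T
  increase leftCol i j i<j = subst₂ _<_ (lookup-leftColumn T i) (lookup-leftColumn T j)
    (Increasing⇒lookup< (leftColumn T) (increasingL cp) i<j)
  increase rightCol i j i<j = subst₂ _<_ (lookup-rightColumn T i) (lookup-rightColumn T j)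
    (Increasing⇒lookup< (rightColumn T) (increasingR cp) i<j)
  injective : ∀ (x y : Cell n) → label T x ≡ label T y → x ≡ y
  injective (i , leftCol) (j , leftCol) eq = cong (_, leftCol)
    (Increasing⇒lookup-injective (leftColumn T) (increasingL cp)
      (trans (lookup-leftColumn T i) (trans (cong toℕ eq) (sym (lookup-leftColumn T j)))))
  injective (i , rightCol) (j , rightCol) eq = cong (_, rightCol)
    (Increasing⇒lookup-injective (rightColumn T) (increasingR cp)
      (trans (lookup-rightColumn T i) (trans (cong toℕ eq) (sym (lookup-rightColumn T j)))))
  injective (i , leftCol) (j , rightCol) eq = ⊥-elim (disjoint cp (label∈leftColumn T i)
    (subst (_∈ rightColumn T) (cong toℕ (sym eq)) (label∈rightColumn T j)))
  injective (i , rightCol) (j , leftCol) eq = ⊥-elim (disjoint cp (label∈leftColumn T j)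
    (subst (_∈ rightColumn T) (cong toℕ eq) (label∈rightColumn T i)))
  surjective : ∀ (m : Fin (2 * n)) → Σ (Cell n) λ x → label T x ≡ m
  surjective m with covers cp (toℕ m) (toℕ<n m)
  ... | inj₁ m∈L = let i , eq = ∈leftColumn T m∈L in (i , leftCol) , toℕ-injective eq
  ... | inj₂ m∈R = let i , eq = ∈rightColumn T m∈R in (i , rightCol) , toℕ-injective eq

toFinVec : ∀ {M k} (v : Vec ℕ k) → .(Below M v) → Vec (Fin M) k
toFinVec []      _   = []
toFinVec (x ∷ v) v<M = fromℕ< (v<M (here refl)) ∷ toFinVec v (λ z∈ → v<M (there z∈))

fromColumns : ∀ {M n} (Ls Rs : Vec ℕ n) → .(Below M Ls) → .(Below M Rs) →
              Vec (Fin M × Fin M) n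
fromColumns Ls Rs Ls<M Rs<M = zip (toFinVec Ls Ls<M) (toFinVec Rs Rs<M)

leftColumn-fromColumns : ∀ {M n} (Ls Rs : Vec ℕ n) .(Ls<M : Below M Ls) .(Rs<M : Below M Rs) →
                         leftColumn (fromColumns {M} Ls Rs Ls<M Rs<M) ≡ Ls
leftColumn-fromColumns []       []       _ _ = refl
leftColumn-fromColumns (l ∷ Ls) (r ∷ Rs) _ _ = cong₂ _∷_ (toℕ-fromℕ< _) (leftColumn-fromColumns Ls Rs _ _)

rightColumn-fromColumns : ∀ {M n} (Ls Rs : Vec ℕ n) .(Ls<M : Below M Ls) .(Rs<M : Below M Rs) →
                          rightColumn (fromColumns {M} Ls Rs Ls<M Rs<M) ≡ Rs
rightColumn-fromColumns []       []       _ _ = refl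
rightColumn-fromColumns (l ∷ Ls) (r ∷ Rs) _ _ = cong₂ _∷_ (toℕ-fromℕ< _) (rightColumn-fromColumns Ls Rs _ _)

fromColumns-columns : ∀ {M n} (T : Vec (Fin M × Fin M) n) .(L<M : Below M (leftColumn T)) .(R<M : Below M (rightColumn T)) →
                      fromColumns (leftColumn T) (rightColumn T) L<M R<M ≡ T
fromColumns-columns []            _ _ = refl
fromColumns-columns ((l , r) ∷ T) _ _ =
  cong₂ _∷_ (cong₂ _,_ (fromℕ<-toℕ l _) (fromℕ<-toℕ r _)) (fromColumns-columns T _ _)

fromColumns-cong : ∀ {M n} {Ls Ls′ Rs Rs′ : Vec ℕ n} .{Ls<M : Below M Ls} .{Rs<M : Below M Rs}
                   .{Ls′<M : Below M Ls′} .{Rs′<M : Below M Rs′} →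
                   Ls ≡ Ls′ → Rs ≡ Rs′ → fromColumns Ls Rs Ls<M Rs<M ≡ fromColumns Ls′ Rs′ Ls′<M Rs′<M
fromColumns-cong refl refl = refl

-- Labellings satisfying (i) that are fillings (no wall condition yet),
-- with a proof-irrelevant witness so that equality is equality of labellings.
isColumnFilling? : ∀ {n} (T : Labelling n) → Dec (IsFilling T × ColumnsIncrease T)
isColumnFilling? T = isFilling? T ×-dec columnsIncrease? T

ColumnFilling : ℕ → Set
ColumnFilling n = Σ (Labelling n) λ T → True (isColumnFilling? T)

≡-ColumnFilling : ∀ {n} {T T′ : Labelling n} {p : True (isColumnFilling? T)} {p′ : True (isColumnFilling? T′)} →
                  T ≡ T′ → _≡_ {A = ColumnFilling n} (T , p) (T′ , p′)
≡-ColumnFilling {T = T} refl = cong (T ,_) (T-irrelevant _ _)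

double : ∀ n → n + n ≡ 2 * n
double n = cong (n +_) (sym (+-identityʳ n))

module _ {n : ℕ} where

  wordColumnPair : ∀ {j} (w : Word n n j) → ColumnPair (2 * n) (proj₁ (columns w)) (proj₂ (columns w))
  wordColumnPair w = subst (λ m → ColumnPair m (proj₁ (columns w)) (proj₂ (columns w))) (double n) (columns-pair w)

  wordFilling : ∀ {j} → Word n n j → Labelling n
  wordFilling w = fromColumns (proj₁ (columns w)) (proj₂ (columns w))
                              (boundedL (wordColumnPair w)) (boundedR (wordColumnPair w))

  leftColumn-wordFilling : ∀ {j} (w : Word n n j) → leftColumn (wordFilling w) ≡ proj₁ (columns w)
  leftColumn-wordFilling w = leftColumn-fromColumns _ _ _ _

  rightColumn-wordFilling : ∀ {j} (w : Word n n j) → rightColumn (wordFilling w) ≡ proj₂ (columns w)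
  rightColumn-wordFilling w = rightColumn-fromColumns _ _ _ _

  wordFilling-valid : ∀ {j} (w : Word n n j) → IsFilling (wordFilling w) × ColumnsIncrease (wordFilling w)
  wordFilling-valid w = ColumnPair⇒filling (wordFilling w)
    (subst₂ (ColumnPair (2 * n)) (sym (leftColumn-wordFilling w)) (sym (rightColumn-wordFilling w)) (wordColumnPair w))

  readFilling : (T : ColumnFilling n) →
                Σ ℕ λ j → Σ (Word n n j) λ w → columns w ≡ (leftColumn (proj₁ T) , rightColumn (proj₁ T))
  readFilling (T , valid) = wordOf n n (leftColumn T) (rightColumn T)
    (subst (λ m → ColumnPair m (leftColumn T) (rightColumn T)) (sym (double n)) (filling⇒ColumnPair T (toWitness valid)))

  fillingWord : ColumnFilling n → Σ ℕ (Word n n)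
  fillingWord T = proj₁ (readFilling T) , proj₁ (proj₂ (readFilling T))

  fillingWord-columns : ∀ T → columns (proj₂ (fillingWord T)) ≡ (leftColumn (proj₁ T) , rightColumn (proj₁ T))
  fillingWord-columns T = proj₂ (proj₂ (readFilling T))

  words↔fillings : Σ ℕ (Word n n) ↔ ColumnFilling n
  words↔fillings = mk↔ₛ′ encode fillingWord encode∘decode decode∘encode
    where
    encode : Σ ℕ (Word n n) → ColumnFilling n
    encode (j , w) = wordFilling w , fromWitness (wordFilling-valid w)
    encode∘decode : ∀ T → encode (fillingWord T) ≡ T
    encode∘decode (T , valid) = ≡-ColumnFilling (trans
      (fromColumns-cong {Ls′<M = boundedL cp} {Rs′<M = boundedR cp} (cong proj₁ columns≡) (cong proj₂ columns≡))
      (fromColumns-columns T (boundedL cp) (boundedR cp)))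
      where
      cp = filling⇒ColumnPair T (toWitness valid)
      columns≡ = fillingWord-columns (T , valid)
    decode∘encode : ∀ w → fillingWord (encode w) ≡ w
    decode∘encode (j , w) = columns-injective (proj₂ (fillingWord (encode (j , w)))) w
      (trans (fillingWord-columns (encode (j , w))) (cong₂ _,_ (leftColumn-wordFilling w) (rightColumn-wordFilling w)))

badRowSet : ∀ {M n} → Vec (Fin M × Fin M) n → Subset n
badRowSet = map (λ p → toℕ (proj₂ p) <ᵇ toℕ (proj₁ p))

∣badRowSet∣ : ∀ {M n} (T : Vec (Fin M × Fin M) n) → ∣ badRowSet T ∣ ≡ badRows (leftColumn T) (rightColumn T)
∣badRowSet∣ []            = refl
∣badRowSet∣ ((l , r) ∷ T) with toℕ r <ᵇ toℕ l
... | true  = cong suc (∣badRowSet∣ T)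
... | false = ∣badRowSet∣ T

∈badRowSet⇒ : ∀ {n} (T : Labelling n) {i} → i ∈ₛ badRowSet T → label T (i , rightCol) <ᶠ label T (i , leftCol)
∈badRowSet⇒ T {i} i∈ =
  <ᵇ⇒< _ _ (subst Tᵇ (sym (trans (sym (lookup-map i (λ p → toℕ (proj₂ p) <ᵇ toℕ (proj₁ p)) T)) ([]=⇒lookup i∈))) tt)

⇒∈badRowSet : ∀ {n} (T : Labelling n) {i} → label T (i , rightCol) <ᶠ label T (i , leftCol) → i ∈ₛ badRowSet T
⇒∈badRowSet T {i} r<l =
  lookup⇒[]= i (badRowSet T) (trans (lookup-map i (λ p → toℕ (proj₂ p) <ᵇ toℕ (proj₁ p)) T) (<ᵇ-true r<l))

rowsOK⇒⊆ : ∀ {n} (W : Subset n) (T : Labelling n) → RowsOK W T → badRowSet T ⊆ W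
rowsOK⇒⊆ W T ok {i} i∈bad with i ∈? W
... | yes i∈W = i∈W
... | no  i∉W = ⊥-elim (<-asym (ok i i∉W) (∈badRowSet⇒ T i∈bad))

⊆⇒rowsOK : ∀ {n} (W : Subset n) (T : Labelling n) → IsFilling T → badRowSet T ⊆ W → RowsOK W T
⊆⇒rowsOK W T (injective , _) bad⊆W i i∉W with toℕ (label T (i , rightCol)) <? toℕ (label T (i , leftCol))
... | yes r<l = ⊥-elim (i∉W (bad⊆W (⇒∈badRowSet T r<l)))
... | no  r≮l = ≤∧≢⇒< (≮⇒≥ r≮l) λ l≡r → distinctCells (injective (i , leftCol) (i , rightCol) (toℕ-injective l≡r))
  where
  distinctCells : (i , leftCol) ≡ (i , rightCol) → ⊥
  distinctCells ()

-- The k-element supersets of B ⊆ {0,…,n-1}, built point by point: a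
-- point of B must be taken, any other point may or may not be.
data Superset : ∀ {n} → Subset n → ℕ → Set where
  done : Superset [] 0
  keep : ∀ {n} {B : Subset n} {k} → Superset B k → Superset (true ∷ B) (suc k)
  skip : ∀ {n} {B : Subset n} {k} → Superset B k → Superset (false ∷ B) k
  add  : ∀ {n} {B : Subset n} {k} → Superset B k → Superset (false ∷ B) (suc k)

Superset↔ : ∀ {n} (B : Subset n) k → Fin (nSupersets n ∣ B ∣ k) ↔ Superset B k
Superset↔ []          zero    = mk↔ₛ′ (λ _ → done) (λ _ → Fin.zero) (λ { done → refl }) (λ { Fin.zero → refl ; (Fin.suc ()) })
Superset↔ []          (suc k) = empty↔ λ ()
Superset↔ (true ∷ B)  zero    = empty↔ λ ()
Superset↔ (true ∷ B)  (suc k) =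
  ↔-trans (Superset↔ B k) (mk↔ₛ′ keep (λ { (keep s) → s }) (λ { (keep s) → refl }) (λ _ → refl))
Superset↔ {suc n} (false ∷ B) zero = ↔-trans (Fin-cong (nSupersets-new₀ n ∣ B ∣ (∣p∣≤n B)))
  (↔-trans (Superset↔ B 0) (mk↔ₛ′ skip (λ { (skip s) → s }) (λ { (skip s) → refl }) (λ _ → refl)))
Superset↔ {suc n} (false ∷ B) (suc k) = ↔-trans (Fin-cong (nSupersets-new n ∣ B ∣ k (∣p∣≤n B)))
  (↔-trans +↔⊎ (↔-trans (Superset↔ B (suc k) ⊎-↔ Superset↔ B k)
    (mk↔ₛ′ (λ { (inj₁ s) → skip s ; (inj₂ s) → add s }) (λ { (skip s) → inj₁ s ; (add s) → inj₂ s })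
           (λ { (skip s) → refl ; (add s) → refl }) (λ { (inj₁ s) → refl ; (inj₂ s) → refl }))))

toSubset : ∀ {n} {B : Subset n} {k} → Superset B k → Subset n
toSubset done     = []
toSubset (keep s) = true ∷ toSubset s
toSubset (skip s) = false ∷ toSubset s
toSubset (add s)  = true ∷ toSubset s

∣toSubset∣ : ∀ {n} {B : Subset n} {k} (s : Superset B k) → ∣ toSubset s ∣ ≡ k
∣toSubset∣ done     = refl
∣toSubset∣ (keep s) = cong suc (∣toSubset∣ s)
∣toSubset∣ (skip s) = ∣toSubset∣ s
∣toSubset∣ (add s)  = cong suc (∣toSubset∣ s)

⊆toSubset : ∀ {n} {B : Subset n} {k} (s : Superset B k) → B ⊆ toSubset s
⊆toSubset done     = λ ()
⊆toSubset (keep s) = s⊆s (⊆toSubset s)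
⊆toSubset (skip s) = s⊆s (⊆toSubset s)
⊆toSubset (add s)  = out⊆ (⊆toSubset s)

fromSubset : ∀ {n} (B W : Subset n) k → ∣ W ∣ ≡ k → B ⊆ W → Superset B k
fromSubset []          []          zero    _    _    = done
fromSubset (true ∷ B)  (true ∷ W)  (suc k) ∣W∣≡ B⊆W = keep (fromSubset B W k (suc-injective ∣W∣≡) (drop-∷-⊆ B⊆W))
fromSubset (true ∷ B)  (false ∷ W) k       _    B⊆W with () ← B⊆W here[]=
fromSubset (false ∷ B) (true ∷ W)  (suc k) ∣W∣≡ B⊆W = add (fromSubset B W k (suc-injective ∣W∣≡) (drop-∷-⊆ B⊆W))
fromSubset (false ∷ B) (false ∷ W) k       ∣W∣≡ B⊆W = skip (fromSubset B W k ∣W∣≡ (drop-∷-⊆ B⊆W))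

toSubset-fromSubset : ∀ {n} (B W : Subset n) k (∣W∣≡ : ∣ W ∣ ≡ k) (B⊆W : B ⊆ W) →
                      toSubset (fromSubset B W k ∣W∣≡ B⊆W) ≡ W
toSubset-fromSubset []          []          zero    _ _   = refl
toSubset-fromSubset (true ∷ B)  (true ∷ W)  (suc k) _ _   = cong (true ∷_) (toSubset-fromSubset B W k _ _)
toSubset-fromSubset (true ∷ B)  (false ∷ W) k       _ B⊆W with () ← B⊆W here[]=
toSubset-fromSubset (false ∷ B) (true ∷ W)  (suc k) _ _   = cong (true ∷_) (toSubset-fromSubset B W k _ _)
toSubset-fromSubset (false ∷ B) (false ∷ W) k       _ _   = cong (false ∷_) (toSubset-fromSubset B W k _ _)

fromSubset-toSubset : ∀ {n} {B : Subset n} {k} (s : Superset B k) (∣W∣≡ : ∣ toSubset s ∣ ≡ k) (B⊆W : B ⊆ toSubset s) →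
                      fromSubset B (toSubset s) k ∣W∣≡ B⊆W ≡ s
fromSubset-toSubset done     _ _ = refl
fromSubset-toSubset (keep s) _ _ = cong keep (fromSubset-toSubset s _ _)
fromSubset-toSubset (skip s) _ _ = cong skip (fromSubset-toSubset s _ _)
fromSubset-toSubset (add s)  _ _ = cong add (fromSubset-toSubset s _ _)

module _ (n k : ℕ) where

  pairs↔ : Pairs n k ↔ Σ (ColumnFilling n) λ T → Superset (badRowSet (proj₁ T)) k
  pairs↔ = mk↔ₛ′ split join split∘join join∘split
    where
    split : Pairs n k → Σ (ColumnFilling n) λ T → Superset (badRowSet (proj₁ T)) k
    split ((W , T) , counted) with toWitness counted
    ... | ∣W∣≡k , filling , increase , rowsOK =
      (T , fromWitness (filling , increase)) , fromSubset (badRowSet T) W k ∣W∣≡k (rowsOK⇒⊆ W T rowsOK)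
    join : (Σ (ColumnFilling n) λ T → Superset (badRowSet (proj₁ T)) k) → Pairs n k
    join ((T , valid) , s) with toWitness valid
    ... | filling , increase = (toSubset s , T) ,
      fromWitness (∣toSubset∣ s , filling , increase , ⊆⇒rowsOK (toSubset s) T filling (⊆toSubset s))
    split∘join : ∀ p → split (join p) ≡ p
    split∘join ((T , valid) , s) = cong₂ (λ v s′ → (T , v) , s′) (T-irrelevant _ _) (fromSubset-toSubset s _ _)
    join∘split : ∀ p → join (split p) ≡ p
    join∘split ((W , T) , counted) = ≡-Pairs (toSubset-fromSubset (badRowSet T) W k _ _)
      where
      ≡-Pairs : ∀ {W′} {c′ : True (counted? n k W′ T)} → W′ ≡ W → _≡_ {A = Pairs n k} ((W′ , T) , c′) ((W , T) , counted)
      ≡-Pairs refl = cong ((W , T) ,_) (T-irrelevant _ _)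

  Fibre : ℕ → Set
  Fibre j = Σ (Word n n j) λ w → Superset (badRowSet (wordFilling w)) k

  ∣badRowSet-wordFilling∣ : ∀ {j} (w : Word n n j) → ∣ badRowSet (wordFilling w) ∣ ≡ j
  ∣badRowSet-wordFilling∣ w = trans (∣badRowSet∣ (wordFilling w))
    (trans (cong₂ badRows (leftColumn-wordFilling w) (rightColumn-wordFilling w)) (columns-flaws w))

  fibre↔ : ∀ j → Fin (nWords n n j * nSupersets n j k) ↔ Fibre j
  fibre↔ j = ↔-trans *↔× (↔-trans (Word↔ n n j ×-↔ ↔-refl)
    (Σ-↔ ↔-refl λ {w} → ↔-trans (Fin-cong (cong (λ b → nSupersets n b k) (sym (∣badRowSet-wordFilling∣ w))))
                                 (Superset↔ (badRowSet (wordFilling w)) k)))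

  pairsCount↔ : Fin (Σ≤ n λ j → nWords n n j * nSupersets n j k) ↔ Pairs n k
  pairsCount↔ =
    ↔-trans (Σ-bounded↔ n _ fibre↔ (flaws≤ ∘ proj₁))
    (↔-trans (↔-sym Σ-assoc)
    (↔-trans (Σ-↔ words↔fillings ↔-refl)
             (↔-sym pairs↔)))

-- The theorem: v = Σ_j nWords n n j · nSupersets n j k counts the pairs
-- and satisfies (n+1-k)·v = C(n,k)·C(2n,n).
mainTheorem1 : (n k : ℕ) → 1 ≤ n → k ≤ n →
    Σ ℕ (λ v → (Fin v ↔ Pairs n k) ×
    ((n + 1 ∸ k) * v ≡ (n C k) * ((2 * n) C n)))
mainTheorem1 n k _ k≤n =
  Σ≤ n (λ j → nWords n n j * nSupersets n j k) , pairsCount↔ n k , countIdentity n k k≤n
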